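{- Let $Y$ be a graph and let $G\le \mathrm{Aut}(Y)$ be a finite group such that $(G,Y)$ is a harmonic group action and the quotient graph $G\backslash Y$ is connected. If the quotient morphism $\phi_G:Y\rightarrow G\backslash Y$ is degenerate at some vertex of $Y$, then $G\backslash Y$ is the point graph (a single vertex and no edges).
   Context: A graph is a finite multigraph without loop edges (two vertices may be joined by several edges, no vertex is joined to itself); graphs may be disconnected. For a vertex $v$ of a graph, $v(1)$ denotes the subgraph consisting of $v$, the vertices adjacent to $v$, and the edges incident to $v$. A morphism of graphs $\phi:Y\to X$ is a map $V(Y)\cup E(Y)\to V(X)\cup E(X)$ sending vertices to vertices such that for each edge $e$ of $Y$ with endpoints $y_1\neq y_2$, either $\phi(e)$ is an edge of $X$ with endpoints $\phi(y_1)\neq\phi(y_2)$, or $\phi(e)=\phi(y_1)=\phi(y_2)$ is a vertex (then $e$ is called $\phi$-vertical). $\phi$ is degenerate at $y\in V(Y)$ if $\phi(y(1))=\{\phi(y)\}$. $\phi$ is harmonic if for every vertex $y$ of $Y$, the number of edges of $y(1)$ mapped to $e'$ is the same for all edges $e'$ of $\phi(y)(1)$. For a finite group $G\le\mathrm{Aut}(Y)$, $(G,Y)$ is a faithful group action if the stabilizer of each connected component of $Y$ acts faithfully on that component. The quotient graph $G\backslash Y$ has as vertices the $G$-orbits of vertices of $Y$ and as edges the $G$-orbits of those edges of $Y$ whose two endpoints lie in different $G$-orbits; the quotient morphism $\phi_G:Y\to G\backslash Y$ sends each vertex and edge to its orbit, except that an edge whose endpoints lie in the same $G$-orbit is sent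 to the orbit of its endpoints. A faithful group action $(G,Y)$ is a harmonic group action if for every subgroup $H\le G$ the quotient morphism $\phi_H:Y\to H\backslash Y$ is harmonic. -}

module Defs where

open import Data.Nat using (ℕ)
open import Data.Fin using (Fin; _≟_)
open import Data.Fin.Subset using (Subset; _∈_; ⊤)
open import Data.Fin.Subset.Properties using (_∈?_)
open import Data.Fin.Properties using (any?)
open import Data.Product using (Σ; _×_; _,_; ∃; ∃-syntax)
open import Data.Product.Properties using ()
open import Data.Sum using (_⊎_)
open import Data.List using (length; filter; allFin)
open import Function.Definitions using (Bijective)
open import Relation.Nullary using (¬_; Dec)
open import Relation.Nullary.Decidable using (_×-dec_; _⊎-dec_)
open import Relation.Unary using (Decidable)
open import Relation.Binary.PropositionalEquality using (_≡_; _≢_)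
open import Relation.Binary.Construct.Closure.ReflexiveTransitive using (Star)

-- Edges are unoriented: the labelling of the two
-- endpoints as src/tgt carries no meaning (automorphisms may swap them).

record Graph : Set where
  field
    nV     : ℕ
    nE     : ℕ
    src    : Fin nE → Fin nV
    tgt    : Fin nE → Fin nV
    noLoop : ∀ e → src e ≢ tgt e

module _ (Y : Graph) where
  open Graph Y

  -- e is an edge of v(1), i.e. e is incident to v
  Incident : Fin nV → Fin nE → Set
  Incident v e = src e ≡ v ⊎ tgt e ≡ v

  incident? : ∀ v → Decidable (Incident v)
  incident? v e = (src e ≟ v) ⊎-dec (tgt e ≟ v)

  Adj : Fin nV → Fin nV → Set
  Adj a b = ∃[ e ] ((src e ≡ a × tgt e ≡ b) ⊎ (src e ≡ b × tgt e ≡ a))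

  SameComponent : Fin nV → Fin nV → Set
  SameComponent = Star Adj

  record Aut : Set where
    field
      fV    : Fin nV → Fin nV
      fE    : Fin nE → Fin nE
      bijV  : Bijective _≡_ _≡_ fV
      bijE  : Bijective _≡_ _≡_ fE
      resp  : ∀ e → (src (fE e) ≡ fV (src e) × tgt (fE e) ≡ fV (tgt e))
                  ⊎ (src (fE e) ≡ fV (tgt e) × tgt (fE e) ≡ fV (src e))
  open Aut public

  IsId : Aut → Set
  IsId g = (∀ v → fV g v ≡ v) × (∀ e → fE g e ≡ e)

  IsComp : Aut → Aut → Aut → Set
  IsComp g h k = (∀ v → fV g v ≡ fV h (fV k v)) × (∀ e → fE g e ≡ fE h (fE k e))

  IsInv : Aut → Aut → Set
  IsInv g h = (∀ v → fV h (fV g v) ≡ v) × (∀ e → fE h (fE g e) ≡ e)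

  -- A finite group G ≤ Aut(Y), given by an enumeration of its elements
  -- elt : Fin order → Aut (repetitions are harmless), closed under
  -- identity, composition and inverses.
  record FinAutGroup : Set where
    field
      order  : ℕ
      elt    : Fin order → Aut
      hasId  : ∃[ i ] IsId (elt i)
      comp   : ∀ i j → ∃[ l ] IsComp (elt l) (elt i) (elt j)
      inv    : ∀ i → ∃[ j ] IsInv (elt i) (elt j)

  module _ (G : FinAutGroup) where
    open FinAutGroup G

    IsSubgroup : Subset order → Set
    IsSubgroup H =
        (∃[ i ] (i ∈ H × IsId (elt i)))
      × (∀ i j → i ∈ H → j ∈ H → ∃[ l ] (l ∈ H × IsComp (elt l) (elt i) (elt j)))
      × (∀ i → i ∈ H → ∃[ j ] (j ∈ H × IsInv (elt i) (elt j)))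

    OrbV : Subset order → Fin nV → Fin nV → Set
    OrbV H a b = ∃[ h ] (h ∈ H × fV (elt h) a ≡ b)

    OrbE : Subset order → Fin nE → Fin nE → Set
    OrbE H e e' = ∃[ h ] (h ∈ H × fE (elt h) e ≡ e')

    orbE? : ∀ H e' → Decidable (λ e → OrbE H e e')
    orbE? H e' e = any? (λ h → (h ∈? H) ×-dec (fE (elt h) e ≟ e'))

    Vertical : Subset order → Fin nE → Set
    Vertical H e = OrbV H (src e) (tgt e)

    Hits : Subset order → Fin nV → Fin nE → Fin nE → Set
    Hits H y e' e = Incident y e × OrbE H e e'

    hits? : ∀ H y e' → Decidable (Hits H y e')
    hits? H y e' e = incident? y e ×-dec orbE? H e' e

    countHits : Subset order → Fin nV → Fin nE → ℕ
    countHits H y e' = length (filter (hits? H y e') (allFin nE))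

    -- φ_H : Y → H\Y is harmonic.  The edges of φ_H(y)(1) in H\Y are the
    -- H-orbits [e'] of non-vertical edges e' having an endpoint in the
    -- H-orbit of y.
    Harmonic : Subset order → Set
    Harmonic H = ∀ y e₁ e₂ →
      ¬ Vertical H e₁ → ¬ Vertical H e₂ →
      (OrbV H (src e₁) y ⊎ OrbV H (tgt e₁) y) →
      (OrbV H (src e₂) y ⊎ OrbV H (tgt e₂) y) →
      countHits H y e₁ ≡ countHits H y e₂

    Faithful : Set
    Faithful = ∀ i v →
      SameComponent v (fV (elt i) v) →
      (∀ w → SameComponent v w → fV (elt i) w ≡ w) →
      (∀ e → SameComponent v (src e) → fE (elt i) e ≡ e) →
      IsId (elt i)

    HarmonicGroupAction : Set
    HarmonicGroupAction = Faithful × (∀ H → IsSubgroup H → Harmonic H)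

    -- the quotient graph G\Y (vertices: G-orbits; edges: G-orbits of
    -- non-vertical edges) is connected: any two orbits [a],[b] are
    -- joined by a path in G\Y.
    QuotStep : Fin nV → Fin nV → Set
    QuotStep a b = OrbV ⊤ a b
      ⊎ ∃[ e ] (¬ Vertical ⊤ e
                × ((OrbV ⊤ (src e) a × OrbV ⊤ (tgt e) b)
                   ⊎ (OrbV ⊤ (src e) b × OrbV ⊤ (tgt e) a)))

    QuotientConnected : Set
    QuotientConnected = ∀ a b → Star QuotStep a b

    -- φ_G is degenerate at y: φ_G(y(1)) = {φ_G(y)}, i.e. every edge of
    -- y(1) and both its endpoints are sent to the orbit of y.
    DegenerateAt : Fin nV → Set
    DegenerateAt y = ∀ e → Incident y e → OrbV ⊤ (src e) y × OrbV ⊤ (tgt e) y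

    -- G\Y is the point graph: a single vertex (one G-orbit; Y is nonempty)
    -- and no edges (every edge of Y is φ_G-vertical).
    QuotientIsPoint : Set
    QuotientIsPoint = (∀ a b → OrbV ⊤ a b) × (∀ e → Vertical ⊤ e)

-- Degeneracy at y says that every edge at y, together with its other
-- endpoint, lies over the orbit [y].  Translating by G, the same holds at
-- every vertex of [y], so no edge of G\Y leaves [y].  Since G\Y is
-- connected, [y] is its only vertex, and then every edge of Y is vertical.
module Submission where

open import Defs
open import Data.Fin using (Fin)
open import Data.Fin.Subset using (⊤)
open import Data.Fin.Subset.Properties using (∈⊤)
open import Data.Product using (_×_; _,_; proj₁; proj₂)
open import Data.Sum using (inj₁; inj₂)
open import Relation.Binary.PropositionalEquality using (_≡_; refl; sym; trans; cong; subst)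
open import Relation.Binary.Construct.Closure.ReflexiveTransitive using (Star; ε; _◅_)

module _ (Y : Graph) (G : FinAutGroup Y) where
  open Graph Y
  open FinAutGroup G

  _∼_ : Fin nV → Fin nV → Set
  _∼_ = OrbV Y G ⊤

  orbit-refl : ∀ {a} → a ∼ a
  orbit-refl {a} with hasId
  ... | i , fixes , _ = i , ∈⊤ , fixes a

  orbit-sym : ∀ {a b} → a ∼ b → b ∼ a
  orbit-sym {a} (h , _ , ha≡b) with inv h
  ... | j , undoes , _ = j , ∈⊤ , trans (cong (fV (elt j)) (sym ha≡b)) (undoes a)

  orbit-trans : ∀ {a b c} → a ∼ b → b ∼ c → a ∼ c
  orbit-trans {a} (h , _ , ha≡b) (k , _ , kb≡c) with comp k h
  ... | l , composes , _ = l , ∈⊤ , trans (composes a) (trans (cong (fV (elt k)) ha≡b) kb≡c)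

  orbit-image : ∀ h a → a ∼ fV (elt h) a
  orbit-image h a = h , ∈⊤ , refl

  incident-image : ∀ h {x e} → Incident Y x e → Incident Y (fV (elt h) x) (fE (elt h) e)
  incident-image h {e = e} inc with resp (elt h) e | inc
  ... | inj₁ (s , _) | inj₁ refl = inj₁ s
  ... | inj₁ (_ , t) | inj₂ refl = inj₂ t
  ... | inj₂ (_ , t) | inj₁ refl = inj₂ t
  ... | inj₂ (s , _) | inj₂ refl = inj₁ s

  preimage-orbit : ∀ h {a b z} → b ≡ fV (elt h) a → b ∼ z → a ∼ z
  preimage-orbit h refl = orbit-trans (orbit-image h _)

  endpoints-preimage : ∀ h e {z} →
    src (fE (elt h) e) ∼ z × tgt (fE (elt h) e) ∼ z → src e ∼ z × tgt e ∼ z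
  endpoints-preimage h e (s∼z , t∼z) with resp (elt h) e
  ... | inj₁ (s≡ , t≡) = preimage-orbit h s≡ s∼z , preimage-orbit h t≡ t∼z
  ... | inj₂ (s≡ , t≡) = preimage-orbit h t≡ t∼z , preimage-orbit h s≡ s∼z

  degenerateAt-orbit : ∀ {x y} → x ∼ y → DegenerateAt Y G y → DegenerateAt Y G x
  degenerateAt-orbit x∼y@(h , _ , hx≡y) deg e inc =
    let s∼y , t∼y = endpoints-preimage h e
                      (deg (fE (elt h) e) (subst (λ v → Incident Y v _) hx≡y (incident-image h inc)))
        y∼x = orbit-sym x∼y
    in orbit-trans s∼y y∼x , orbit-trans t∼y y∼x

  quotStep-degenerate : ∀ {y a b} → DegenerateAt Y G y → a ∼ y → QuotStep Y G a b → b ∼ y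
  quotStep-degenerate deg a∼y (inj₁ a∼b) = orbit-trans (orbit-sym a∼b) a∼y
  quotStep-degenerate deg a∼y (inj₂ (e , _ , inj₁ (s∼a , t∼b))) =
    let s∼y = orbit-trans s∼a a∼y
        t∼s = proj₂ (degenerateAt-orbit s∼y deg e (inj₁ refl))
    in orbit-trans (orbit-sym t∼b) (orbit-trans t∼s s∼y)
  quotStep-degenerate deg a∼y (inj₂ (e , _ , inj₂ (s∼b , t∼a))) =
    let t∼y = orbit-trans t∼a a∼y
        s∼t = proj₁ (degenerateAt-orbit t∼y deg e (inj₂ refl))
    in orbit-trans (orbit-sym s∼b) (orbit-trans s∼t t∼y)

  quotPath-degenerate : ∀ {y a b} → DegenerateAt Y G y → a ∼ y → Star (QuotStep Y G) a b → b ∼ y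
  quotPath-degenerate deg a∼y ε            = a∼y
  quotPath-degenerate deg a∼y (step ◅ path) =
    quotPath-degenerate deg (quotStep-degenerate deg a∼y step) path

proposition2p6 : (Y : Graph) (G : FinAutGroup Y) →
    HarmonicGroupAction Y G →
    QuotientConnected Y G →
    (y : Fin (Graph.nV Y)) → DegenerateAt Y G y →
    QuotientIsPoint Y G
proposition2p6 Y G _ connected y deg =
  (λ a b → orbit-trans Y G (all∼y a) (orbit-sym Y G (all∼y b))) ,
  (λ e → orbit-trans Y G (all∼y (Graph.src Y e)) (orbit-sym Y G (all∼y (Graph.tgt Y e))))
  where
  all∼y : ∀ a → OrbV Y G ⊤ a y
  all∼y a = quotPath-degenerate Y G deg (orbit-refl Y G) (connected y a)
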